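{- Let $K$ be a field, let $V=K^3$ be the space of columns and $V'$ the space of rows of length 3, with standard bases $e_1,e_2,e_3$ and $e^1,e^2,e^3$. Let $\varphi\in GL_3(K)$ act on $V$ by $v\mapsto\varphi v$ and on $V'$ by $v'\mapsto v'\varphi^{ -1}$, and suppose it maps the set of lines $\{\langle e_1+e_2\rangle,\langle e_1+e_3\rangle,\langle e_2+e_3\rangle\}$ in $V$ onto itself and the set $\{\langle e^1\rangle,\langle e^2\rangle,\langle e^3\rangle\}$ in $V'$ onto itself. Then $\varphi=\lambda\tilde\sigma$ for some $\lambda\in K^\ast$ and some $\sigma\in S_3$, where $\tilde\sigma$ is the permutation matrix with $\tilde\sigma e_i=e_{\sigma(i)}$. -}

module Defs where

open import Level using (_⊔_)
open import Algebra.Bundles using (CommutativeRing)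
open import Data.Fin using (Fin; zero; suc; _≟_)
open import Data.Fin.Permutation using (Permutation′; _⟨$⟩ʳ_)
open import Data.Product using (∃; _×_; Σ)
open import Relation.Nullary using (¬_; yes; no)

record Field (c ℓ : Level.Level) : Set (Level.suc (c ⊔ ℓ)) where
  field
    commutativeRing : CommutativeRing c ℓ
  open CommutativeRing commutativeRing public
  field
    0≉1     : ¬ (0# ≈ 1#)
    inverse : ∀ x → ¬ (x ≈ 0#) → ∃ λ y → x * y ≈ 1#

module Over {c ℓ} (K : Field c ℓ) where
  open Field K using (Carrier; _≈_; _+_; _*_; 0#; 1#)

  -- column vectors / row vectors of length 3, and 3×3 matrices (row index first)
  Col : Set c
  Col = Fin 3 → Carrier

  Row : Set c
  Row = Fin 3 → Carrier

  Mat : Set c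
  Mat = Fin 3 → Fin 3 → Carrier

  Σ₃ : (Fin 3 → Carrier) → Carrier
  Σ₃ f = f zero + f (suc zero) + f (suc (suc zero))

  δ : Fin 3 → Fin 3 → Carrier
  δ i j with i ≟ j
  ... | yes _ = 1#
  ... | no  _ = 0#

  _·_ : Mat → Mat → Mat
  (A · B) i j = Σ₃ (λ k → A i k * B k j)

  I : Mat
  I = δ

  _▸_ : Mat → Col → Col
  (A ▸ v) i = Σ₃ (λ k → A i k * v k)

  _◂_ : Row → Mat → Row
  (v ◂ A) j = Σ₃ (λ k → v k * A k j)

  _≈M_ : Mat → Mat → Set ℓ
  A ≈M B = ∀ i j → A i j ≈ B i j

  _≈V_ : (Fin 3 → Carrier) → (Fin 3 → Carrier) → Set ℓ
  u ≈V w = ∀ i → u i ≈ w i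

  IsInverse : Mat → Mat → Set ℓ
  IsInverse φ ψ = ((φ · ψ) ≈M I) × ((ψ · φ) ≈M I)

  e : Fin 3 → Col
  e i = δ i

  e′ : Fin 3 → Row
  e′ i = δ i

  _⊕_ : (Fin 3 → Carrier) → (Fin 3 → Carrier) → (Fin 3 → Carrier)
  (u ⊕ w) i = u i + w i

  Subset : Set (c ⊔ Level.suc (c ⊔ ℓ))
  Subset = (Fin 3 → Carrier) → Set (c ⊔ ℓ)

  ⟨_⟩ : (Fin 3 → Carrier) → Subset
  ⟨ v ⟩ x = ∃ λ t → x ≈V (λ i → t * v i)

  _≐_ : Subset → Subset → Set (c ⊔ ℓ)
  P ≐ Q = ∀ x → (P x → Q x) × (Q x → P x)

  imgCol : Mat → Subset → Subset
  imgCol φ P x = ∃ λ y → P y × (x ≈V (φ ▸ y))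

  -- image of a subset of V' under v' ↦ v' ψ   (ψ = φ⁻¹)
  imgRow : Mat → Subset → Subset
  imgRow ψ P x = ∃ λ y → P y × (x ≈V (y ◂ ψ))

  𝓛 : Fin 3 → Subset
  𝓛 zero = ⟨ e zero ⊕ e (suc zero) ⟩
  𝓛 (suc zero) = ⟨ e zero ⊕ e (suc (suc zero)) ⟩
  𝓛 (suc (suc zero)) = ⟨ e (suc zero) ⊕ e (suc (suc zero)) ⟩

  𝓛′ : Fin 3 → Subset
  𝓛′ i = ⟨ e′ i ⟩

  MapsOnto : (Subset → Subset) → (Fin 3 → Subset) → Set (c ⊔ ℓ)
  MapsOnto f L = (∀ i → ∃ λ j → f (L i) ≐ L j) × (∀ j → ∃ λ i → f (L i) ≐ L j)

  -- permutation matrix σ̃ with σ̃ e_j = e_{σ(j)}, i.e. σ̃_{k j} = δ_{k, σ(j)}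
  permMat : Permutation′ 3 → Mat
  permMat σ k j = δ k (σ ⟨$⟩ʳ j)

-- Every row of ψ = φ⁻¹ is sent to a coordinate line, so row i of ψ is s_i e^{τ(i)}.  Reading
-- ψ φ = I row by row gives s_i φ_{τ(i) b} = δ_{i b}: column b of φ is d_b e_{τ(b)} with d_b ≠ 0,
-- and τ is injective, hence a permutation.  Then φ (e_p + e_q) has exactly the two nonzero
-- coordinates d_p and d_q, while all nonzero coordinates of a point of ⟨e_a + e_b⟩ agree;
-- so the column condition forces d_1 = d_2 = d_3.
module Submission where

open import Defs
open import Algebra.Bundles using (CommutativeRing)
import Algebra.Properties.CommutativeSemigroup as CommutativeSemigroupProperties
open import Data.Empty using (⊥-elim)
open import Data.Fin using (Fin; punchOut)
open import Data.Fin.Patterns using (0F; 1F; 2F)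
open import Data.Fin.Permutation using (Permutation′; permutation)
open import Data.Fin.Properties using (_≟_; any?; punchOut-injective; <⇒notInjective)
open import Data.Nat using (suc)
open import Data.Nat.Properties using (n<1+n)
open import Data.Product using (∃; _×_; _,_; proj₁; proj₂)
open import Function.Base using (_∘_)
open import Function.Definitions using (Injective)
open import Relation.Binary.PropositionalEquality as ≡ using (_≡_; _≢_)
open import Relation.Nullary using (¬_; yes; no; contradiction)

injective⇒surjective : ∀ {n} {f : Fin n → Fin n} → Injective _≡_ _≡_ f → ∀ j → ∃ λ i → f i ≡ j
injective⇒surjective {suc n} {f} f-injective j with any? (λ i → f i ≟ j)
... | yes hit = hit
... | no miss = ⊥-elim (<⇒notInjective (n<1+n n) punchOut∘f-injective)
  where
  j≢f : ∀ i → j ≢ f i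
  j≢f i j≡fi = miss (i , ≡.sym j≡fi)
  punchOut∘f-injective : Injective _≡_ _≡_ (λ i → punchOut (j≢f i))
  punchOut∘f-injective eq = f-injective (punchOut-injective (j≢f _) (j≢f _) eq)

-- The forward map of the permutation is f itself, definitionally.
injective⇒permutation : ∀ {n} {f : Fin n → Fin n} → Injective _≡_ _≡_ f → Permutation′ n
injective⇒permutation {f = f} f-injective =
  permutation f (proj₁ ∘ surjective) (proj₂ ∘ surjective)
              (λ i → f-injective (proj₂ (surjective (f i))))
  where surjective = injective⇒surjective f-injective

module _ {c ℓ} (R : CommutativeRing c ℓ) where
  open CommutativeRing R
  open import Relation.Binary.Reasoning.Setoid setoid

  unit-*≈0⇒≈0 : ∀ {a b x} → a * b ≈ 1# → a * x ≈ 0# → x ≈ 0#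
  unit-*≈0⇒≈0 {a} {b} {x} ab≈1 ax≈0 = begin
    x            ≈⟨ sym (*-identityˡ x) ⟩
    1# * x       ≈⟨ *-congʳ (sym ab≈1) ⟩
    (a * b) * x  ≈⟨ *-congʳ (*-comm a b) ⟩
    (b * a) * x  ≈⟨ *-assoc b a x ⟩
    b * (a * x)  ≈⟨ *-congˡ ax≈0 ⟩
    b * 0#       ≈⟨ zeroʳ b ⟩
    0#           ∎

module _ {c ℓ} (K : Field c ℓ) where
  open Field K renaming (refl to ≈-refl; sym to ≈-sym; trans to ≈-trans)
  open Over K
  open import Relation.Binary.Reasoning.Setoid setoid
  open CommutativeSemigroupProperties +-commutativeSemigroup using (interchange)

  unit⇒≉0 : ∀ {a x} → a * x ≈ 1# → ¬ x ≈ 0#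
  unit⇒≉0 {a} ax≈1 x≈0 = 0≉1 (≈-trans (≈-sym (≈-trans (*-congˡ x≈0) (zeroʳ a))) ax≈1)

  δ-diag : ∀ i → δ i i ≈ 1#
  δ-diag i with i ≟ i
  ... | yes _ = ≈-refl
  ... | no i≢i = contradiction ≡.refl i≢i

  δ-offdiag : ∀ {i j} → i ≢ j → δ i j ≈ 0#
  δ-offdiag {i} {j} i≢j with i ≟ j
  ... | yes i≡j = contradiction i≡j i≢j
  ... | no _ = ≈-refl

  Σ₃-cong : ∀ {f g : Fin 3 → Carrier} → (∀ k → f k ≈ g k) → Σ₃ f ≈ Σ₃ g
  Σ₃-cong f≈g = +-cong (+-cong (f≈g 0F) (f≈g 1F)) (f≈g 2F)

  Σ₃-+ : ∀ (f g : Fin 3 → Carrier) → Σ₃ (λ k → f k + g k) ≈ Σ₃ f + Σ₃ g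
  Σ₃-+ f g = ≈-sym (≈-trans (interchange _ _ _ _) (+-congʳ (interchange _ _ _ _)))

  *-distribˡ-Σ₃ : ∀ a (f : Fin 3 → Carrier) → a * Σ₃ f ≈ Σ₃ (λ k → a * f k)
  *-distribˡ-Σ₃ a f = ≈-trans (distribˡ a _ _) (+-congʳ (distribˡ a _ _))

  Σ₃-δ : ∀ i (f : Fin 3 → Carrier) → Σ₃ (λ k → δ i k * f k) ≈ f i
  Σ₃-δ 0F f = ≈-trans (+-cong (+-cong (*-identityˡ _) (zeroˡ _)) (zeroˡ _))
                      (≈-trans (+-identityʳ _) (+-identityʳ _))
  Σ₃-δ 1F f = ≈-trans (+-cong (+-cong (zeroˡ _) (*-identityˡ _)) (zeroˡ _))
                      (≈-trans (+-identityʳ _) (+-identityˡ _))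
  Σ₃-δ 2F f = ≈-trans (+-cong (+-cong (zeroˡ _) (zeroˡ _)) (*-identityˡ _))
                      (≈-trans (+-congʳ (+-identityˡ _)) (+-identityˡ _))

  ▸-e : ∀ (A : Mat) i j → (A ▸ e j) i ≈ A i j
  ▸-e A i j = ≈-trans (Σ₃-cong (λ k → *-comm (A i k) (δ j k))) (Σ₃-δ j (A i))

  ▸-⊕ : ∀ (A : Mat) u w i → (A ▸ (u ⊕ w)) i ≈ (A ▸ u) i + (A ▸ w) i
  ▸-⊕ A u w i = ≈-trans (Σ₃-cong (λ k → distribˡ (A i k) (u k) (w k)))
                        (Σ₃-+ (λ k → A i k * u k) (λ k → A i k * w k))

  e′◂ : ∀ i (A : Mat) k → (e′ i ◂ A) k ≈ A i k
  e′◂ i A k = Σ₃-δ i (λ m → A m k)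

  ⟨⟩-self : ∀ v → ⟨ v ⟩ v
  ⟨⟩-self v = 1# , λ _ → ≈-sym (*-identityˡ _)

  imgCol-⟨⟩ : ∀ φ v {P : Subset} → imgCol φ ⟨ v ⟩ ≐ P → P (φ ▸ v)
  imgCol-⟨⟩ φ v img≐P = proj₁ (img≐P _) (v , ⟨⟩-self v , λ _ → ≈-refl)

  imgRow-⟨⟩ : ∀ ψ v {P : Subset} → imgRow ψ ⟨ v ⟩ ≐ P → P (v ◂ ψ)
  imgRow-⟨⟩ ψ v img≐P = proj₁ (img≐P _) (v , ⟨⟩-self v , λ _ → ≈-refl)

  imgRow-𝓛′⇒row : ∀ ψ i j → imgRow ψ (𝓛′ i) ≐ 𝓛′ j → ∃ λ s → ∀ k → ψ i k ≈ s * δ j k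
  imgRow-𝓛′⇒row ψ i j img≐𝓛′ with imgRow-⟨⟩ ψ (e′ i) img≐𝓛′
  ... | s , row≈ = s , λ k → ≈-trans (≈-sym (e′◂ i ψ k)) (row≈ k)

  *[1+0]≈ : ∀ t → t * (1# + 0#) ≈ t
  *[1+0]≈ t = ≈-trans (*-congˡ (+-identityʳ 1#)) (*-identityʳ t)

  *[0+1]≈ : ∀ t → t * (0# + 1#) ≈ t
  *[0+1]≈ t = ≈-trans (*-congˡ (+-identityˡ 1#)) (*-identityʳ t)

  *[0+0]≈0 : ∀ t → t * (0# + 0#) ≈ 0#
  *[0+0]≈0 t = ≈-trans (*-congˡ (+-identityʳ 0#)) (zeroʳ t)

  𝓛-nonzero-coords : ∀ j {x} → 𝓛 j x → ∃ λ t → ∀ p → ¬ x p ≈ 0# → x p ≈ t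
  𝓛-nonzero-coords 0F (t , x≈) = t , λ
    { 0F _ → ≈-trans (x≈ 0F) (*[1+0]≈ t)
    ; 1F _ → ≈-trans (x≈ 1F) (*[0+1]≈ t)
    ; 2F x₂≉0 → contradiction (≈-trans (x≈ 2F) (*[0+0]≈0 t)) x₂≉0 }
  𝓛-nonzero-coords 1F (t , x≈) = t , λ
    { 0F _ → ≈-trans (x≈ 0F) (*[1+0]≈ t)
    ; 1F x₁≉0 → contradiction (≈-trans (x≈ 1F) (*[0+0]≈0 t)) x₁≉0
    ; 2F _ → ≈-trans (x≈ 2F) (*[0+1]≈ t) }
  𝓛-nonzero-coords 2F (t , x≈) = t , λ
    { 0F x₀≉0 → contradiction (≈-trans (x≈ 0F) (*[0+0]≈0 t)) x₀≉0
    ; 1F _ → ≈-trans (x≈ 1F) (*[1+0]≈ t)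
    ; 2F _ → ≈-trans (x≈ 2F) (*[0+1]≈ t) }

  𝓛-nonzero-coords-equal : ∀ j {x p q} → 𝓛 j x → ¬ x p ≈ 0# → ¬ x q ≈ 0# → x p ≈ x q
  𝓛-nonzero-coords-equal j {p = p} {q} x∈𝓛 xp≉0 xq≉0 with 𝓛-nonzero-coords j x∈𝓛
  ... | t , coord≈t = ≈-trans (coord≈t p xp≉0) (≈-sym (coord≈t q xq≉0))

  module MonomialLeftInverse
    (φ ψ : Mat) (ψφ≈I : (ψ · φ) ≈M I)
    (τ : Fin 3 → Fin 3) (s : Fin 3 → Carrier) (ψ-rows : ∀ i k → ψ i k ≈ s i * δ (τ i) k)
    where

    s*φ-row : ∀ i b → s i * φ (τ i) b ≈ δ i b
    s*φ-row i b = begin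
      s i * φ (τ i) b                       ≈⟨ *-congˡ (Σ₃-δ (τ i) (λ k → φ k b)) ⟨
      s i * Σ₃ (λ k → δ (τ i) k * φ k b)    ≈⟨ *-distribˡ-Σ₃ (s i) (λ k → δ (τ i) k * φ k b) ⟩
      Σ₃ (λ k → s i * (δ (τ i) k * φ k b))  ≈⟨ Σ₃-cong (λ k → ≈-trans (*-congʳ (ψ-rows i k))
                                                                     (*-assoc (s i) (δ (τ i) k) (φ k b))) ⟨
      Σ₃ (λ k → ψ i k * φ k b)              ≈⟨ ψφ≈I i b ⟩
      δ i b                                 ∎

    d : Fin 3 → Carrier
    d i = φ (τ i) i

    s*d≈1 : ∀ i → s i * d i ≈ 1#
    s*d≈1 i = ≈-trans (s*φ-row i i) (δ-diag i)

    d≉0 : ∀ i → ¬ d i ≈ 0#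
    d≉0 i = unit⇒≉0 (s*d≈1 i)

    φ-offdiag : ∀ {i b} → i ≢ b → φ (τ i) b ≈ 0#
    φ-offdiag {i} i≢b =
      unit-*≈0⇒≈0 commutativeRing (s*d≈1 i) (≈-trans (s*φ-row i _) (δ-offdiag i≢b))

    τ-injective : Injective _≡_ _≡_ τ
    τ-injective {i} {i′} τi≡τi′ with i ≟ i′
    ... | yes i≡i′ = i≡i′
    ... | no i≢i′ = contradiction dᵢ≈0 (d≉0 i)
      where
      dᵢ≈0 : d i ≈ 0#
      dᵢ≈0 = ≡.subst (λ m → φ m i ≈ 0#) (≡.sym τi≡τi′) (φ-offdiag (i≢i′ ∘ ≡.sym))

    φ≈d*δ : ∀ m b → φ m b ≈ d b * δ m (τ b)
    φ≈d*δ m b with injective⇒surjective τ-injective m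
    ... | i , ≡.refl with i ≟ b
    ...   | yes ≡.refl = ≈-sym (≈-trans (*-congˡ (δ-diag (τ i))) (*-identityʳ _))
    ...   | no i≢b = ≈-trans (φ-offdiag i≢b)
                             (≈-sym (≈-trans (*-congˡ (δ-offdiag (i≢b ∘ τ-injective))) (zeroʳ _)))

    d-equal : ∀ j {p q} → p ≢ q → 𝓛 j (φ ▸ (e p ⊕ e q)) → d p ≈ d q
    d-equal j {p} {q} p≢q image∈𝓛 = begin
      d p                          ≈⟨ image-at-τp ⟨
      (φ ▸ (e p ⊕ e q)) (τ p)      ≈⟨ 𝓛-nonzero-coords-equal j image∈𝓛 (≉0-resp image-at-τp (d≉0 p))
                                                                      (≉0-resp image-at-τq (d≉0 q)) ⟩
      (φ ▸ (e p ⊕ e q)) (τ q)      ≈⟨ image-at-τq ⟩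
      d q                          ∎
      where
      ≉0-resp : ∀ {x y} → x ≈ y → ¬ y ≈ 0# → ¬ x ≈ 0#
      ≉0-resp x≈y y≉0 x≈0 = y≉0 (≈-trans (≈-sym x≈y) x≈0)
      columns : ∀ m → (φ ▸ (e p ⊕ e q)) m ≈ φ m p + φ m q
      columns m = ≈-trans (▸-⊕ φ (e p) (e q) m) (+-cong (▸-e φ m p) (▸-e φ m q))
      image-at-τp : (φ ▸ (e p ⊕ e q)) (τ p) ≈ d p
      image-at-τp = ≈-trans (columns (τ p)) (≈-trans (+-congˡ (φ-offdiag p≢q)) (+-identityʳ _))
      image-at-τq : (φ ▸ (e p ⊕ e q)) (τ q) ≈ d q
      image-at-τq = ≈-trans (columns (τ q)) (≈-trans (+-congʳ (φ-offdiag (p≢q ∘ ≡.sym))) (+-identityˡ _))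

lemma6p9 : ∀ {c ℓ} (K : Field c ℓ) → let open Over K in
    (φ ψ : Mat) → IsInverse φ ψ →
    MapsOnto (imgCol φ) 𝓛 →
    MapsOnto (imgRow ψ) 𝓛′ →
    ∃ λ (t : Field.Carrier K) → ¬ (Field._≈_ K t (Field.0# K)) × (∃ λ (σ : Permutation′ 3) → ∀ i j → Field._≈_ K (φ i j) (Field._*_ K t (permMat σ i j)))
lemma6p9 K φ ψ (_ , ψφ≈I) (𝓛-images , _) (𝓛′-images , _) =
  d 0F , d≉0 0F , injective⇒permutation τ-injective , λ i j → trans (φ≈d*δ i j) (*-congʳ (d≈d₀ j))
  where
  open Field K using (_≈_; _*_; refl; sym; trans; *-congʳ)
  open Over K using (δ)

  τ : Fin 3 → Fin 3
  τ i = proj₁ (𝓛′-images i)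

  rows : ∀ i → ∃ λ s → ∀ k → ψ i k ≈ s * δ (τ i) k
  rows i = imgRow-𝓛′⇒row K ψ i (τ i) (proj₂ (𝓛′-images i))

  open MonomialLeftInverse K φ ψ ψφ≈I τ (proj₁ ∘ rows) (proj₂ ∘ rows)

  d≈d₀ : ∀ j → d j ≈ d 0F
  d≈d₀ 0F = refl
  d≈d₀ 1F with 𝓛-images 0F
  ... | j , image≐𝓛ⱼ = sym (d-equal j (λ ()) (imgCol-⟨⟩ K φ _ image≐𝓛ⱼ))
  d≈d₀ 2F with 𝓛-images 1F
  ... | j , image≐𝓛ⱼ = sym (d-equal j (λ ()) (imgCol-⟨⟩ K φ _ image≐𝓛ⱼ))
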